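{- For all integers $m$ and $n$ with $m\ge n\ge 6$, there exists an orientation $D$ of the complete bipartite graph $K_{m,n}$ such that $|E(C_{1,2}(D))|=\binom{m+n}{2}$.
   Context: For vertices $x,y$ of a digraph $H$, $d_H(x,y)$ is the length of a shortest directed $(x,y)$-path. The $(1,2)$-step competition graph $C_{1,2}(D)$ of a digraph $D$ is the simple graph on $V(D)$ in which distinct $u,v$ are adjacent iff there is $w\neq u,v$ with either $d_{D-v}(u,w)\le 1$ and $d_{D-u}(v,w)\le 2$, or $d_{D-u}(v,w)\le 1$ and $d_{D-v}(u,w)\le 2$. -}

module Defs where

open import Data.Nat using (ℕ; _+_; _<_; _≤_)
open import Data.Fin using (Fin; toℕ)
import Data.Fin as F
open import Data.Product using (Σ; _×_; _,_; ∃; ∃-syntax)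
open import Data.Sum using (_⊎_)
open import Data.List using (List; length)
open import Data.List.Membership.Propositional using (_∈_)
open import Data.List.Relation.Unary.Unique.Propositional using (Unique)
open import Relation.Binary.PropositionalEquality using (_≡_; _≢_)
open import Relation.Nullary using (¬_)
open import Function.Bundles using (_⇔_)

Digraph : ℕ → Set₁
Digraph N = Fin N → Fin N → Set

Graph : ℕ → Set₁
Graph N = Fin N → Fin N → Set

-- K_{m,n} on vertex set Fin (m + n): part X = {i | toℕ i < m}, part Y = the rest.
-- x and y lie in different parts.
OppositeParts : (m n : ℕ) → Fin (m + n) → Fin (m + n) → Set
OppositeParts m n x y = (toℕ x < m × m ≤ toℕ y) ⊎ (m ≤ toℕ x × toℕ y < m)

IsOrientationKmn : (m n : ℕ) → Digraph (m + n) → Set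
IsOrientationKmn m n D =
  (∀ x y → D x y → OppositeParts m n x y)
  × (∀ x y → OppositeParts m n x y → D x y ⊎ D y x)
  × (∀ x y → ¬ (D x y × D y x))

-- d_{D - r}(u , w) ≤ 1   (u , w vertices of D - r)
Dist≤1 : ∀ {N} → Digraph N → (r u w : Fin N) → Set
Dist≤1 D r u w = u ≢ r × w ≢ r × (u ≡ w ⊎ D u w)

-- d_{D - r}(u , w) ≤ 2   (u , w vertices of D - r; intermediate vertex avoids r)
Dist≤2 : ∀ {N} → Digraph N → (r u w : Fin N) → Set
Dist≤2 D r u w =
  Dist≤1 D r u w ⊎ (u ≢ r × w ≢ r × ∃[ z ] (z ≢ r × D u z × D z w))

C12 : ∀ {N} → Digraph N → Graph N
C12 D u v =
  u ≢ v × ∃[ w ] (w ≢ u × w ≢ v ×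
     ((Dist≤1 D v u w × Dist≤2 D u v w) ⊎ (Dist≤1 D u v w × Dist≤2 D v u w)))

EdgeCount : ∀ {N} → Graph N → ℕ → Set
EdgeCount {N} G k =
  Σ (List (Fin N × Fin N)) λ L →
    Unique L
    × (∀ x y → ((x , y) ∈ L) ⇔ (x F.< y × G x y))
    × length L ≡ k

-- Fix an orientation T of K_{6,6} and blow it up to K_{m,n}: every surplus
-- vertex of X beats all of Y, every surplus vertex of Y beats the six core
-- vertices of X.  An arc of the blow-up depends only on the labels of its ends
-- (a core vertex, or the surplus class of X or Y), so it suffices to find, for
-- every pair of labels, a (1,2)-step competition witness among the twelve core
-- labels; for the T below this is a finite check.  Such a witness lifts to any
-- two distinct vertices, so C_{1,2}(D) is complete.
module Submission where

open import Defs
open import Data.Bool using (Bool; true; false; not; T)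
open import Data.Empty using (⊥-elim)
open import Data.Fin using (Fin; zero; suc; toℕ; splitAt; _↑ˡ_; _↑ʳ_)
import Data.Fin as F
open import Data.Fin.Properties using (any?; all?; <⇒≢; splitAt-<; splitAt-≥; splitAt-↑ˡ; splitAt-↑ʳ)
open import Data.List using (List; map; _++_; length; allFin)
open import Data.List.Membership.Propositional using (_∈_)
open import Data.List.Membership.Propositional.Properties using (∈-map⁺; ∈-map⁻; ∈-++⁺ˡ; ∈-++⁺ʳ; ∈-++⁻; ∈-allFin)
open import Data.List.Properties using (length-++; length-map; length-tabulate)
open import Data.List.Relation.Unary.Unique.Propositional using (Unique)
open import Data.List.Relation.Unary.AllPairs using ([])
open import Data.List.Relation.Unary.Unique.Propositional.Properties using (map⁺; ++⁺; allFin⁺)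
open import Data.Nat using (ℕ; _+_; _<_; _≤_; s≤s; z≤n)
open import Data.Nat.Combinatorics using (_C_; nC1≡n; nCk+nC[k+1]≡[n+1]C[k+1])
open import Data.Nat.Properties using (_<?_; ≤-trans; ≮⇒≥; m≤n⇒∃[o]m+o≡n)
open import Data.Product using (_×_; _,_; proj₁; ∃; ∃-syntax)
import Data.Product as Product
open import Data.Sum using (_⊎_; inj₁; inj₂; [_,_]′)
open import Data.Vec using (Vec; []; _∷_; lookup)
open import Function using (_∘_; const)
open import Function.Bundles using (mk⇔)
open import Relation.Binary.Definitions using (DecidableEquality)
open import Relation.Binary.PropositionalEquality using (_≡_; _≢_; refl; sym; trans; cong; cong₂)
open import Relation.Nullary using (Dec; yes; no; ¬_; ¬?)
open import Relation.Nullary.Decidable using (map′; _×-dec_; _⊎-dec_; _→-dec_; from-yes; T?)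
open import Relation.Unary using (Decidable)

pairs : (N : ℕ) → List (Fin N × Fin N)
pairs 0         = List.[]
pairs (ℕ.suc N) = map (λ j → zero , suc j) (allFin N) ++ map (Product.map suc suc) (pairs N)

length-pairs : ∀ N → length (pairs N) ≡ N C 2
length-pairs 0 = refl
length-pairs (ℕ.suc N) = begin
  length (map _ (allFin N) ++ map _ (pairs N))  ≡⟨ length-++ (map _ (allFin N)) ⟩
  length (map _ (allFin N)) + length (map _ (pairs N))
    ≡⟨ cong₂ _+_ (trans (length-map _ (allFin N)) (length-tabulate _))
                 (trans (length-map _ (pairs N)) (length-pairs N)) ⟩
  N + N C 2                                     ≡⟨ cong (_+ N C 2) (sym (nC1≡n N)) ⟩
  N C 1 + N C 2                                 ≡⟨ nCk+nC[k+1]≡[n+1]C[k+1] N 1 ⟩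
  ℕ.suc N C 2                                   ∎
  where open Relation.Binary.PropositionalEquality.≡-Reasoning

∈-pairs⁻ : ∀ N {i j : Fin N} → (i , j) ∈ pairs N → i F.< j
∈-pairs⁻ (ℕ.suc N) h with ∈-++⁻ (map (λ j → zero , suc j) (allFin N)) h
... | inj₁ h₁ with ∈-map⁻ _ h₁
...   | _ , _ , refl = s≤s z≤n
∈-pairs⁻ (ℕ.suc N) h | inj₂ h₂ with ∈-map⁻ _ h₂
...   | _ , h₃ , refl = s≤s (∈-pairs⁻ N h₃)

∈-pairs⁺ : ∀ N {i j : Fin N} → i F.< j → (i , j) ∈ pairs N
∈-pairs⁺ (ℕ.suc N) {zero}  {suc j} _ = ∈-++⁺ˡ (∈-map⁺ (λ j → zero , suc j) (∈-allFin j))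
∈-pairs⁺ (ℕ.suc N) {suc i} {suc j} (s≤s i<j) =
  ∈-++⁺ʳ (map (λ j → zero , suc j) (allFin N)) (∈-map⁺ (Product.map suc suc) (∈-pairs⁺ N i<j))

pairs-unique : ∀ N → Unique (pairs N)
pairs-unique 0 = []
pairs-unique (ℕ.suc N) =
  ++⁺ (map⁺ (λ { refl → refl }) (allFin⁺ N)) (map⁺ (λ { {_ , _} {_ , _} refl → refl }) (pairs-unique N)) disjoint
  where
  disjoint : ∀ {p} → ¬ (p ∈ map (λ j → zero , suc j) (allFin N) × p ∈ map (Product.map suc suc) (pairs N))
  disjoint (h₁ , h₂) with ∈-map⁻ _ h₁ | ∈-map⁻ _ h₂
  ... | _ , _ , refl | _ , _ , ()

EdgeCount-complete : ∀ {N} (G : Graph N) → (∀ {u v} → u ≢ v → G u v) → EdgeCount G (N C 2)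
EdgeCount-complete {N} G complete =
  pairs N , pairs-unique N ,
  (λ u v → mk⇔ (λ h → ∈-pairs⁻ N h , complete (<⇒≢ (∈-pairs⁻ N h))) (∈-pairs⁺ N ∘ proj₁)) ,
  length-pairs N

module Competition {C K : Set} (A : C → C → Set) (ι : K → C) where

  -- Witnesses and middle vertices range over ι K, the labels known to be carried by a vertex.
  Path≤2 : (r v w : C) → Set
  Path≤2 r v w = A v w ⊎ ∃ λ z → ι z ≢ r × A v (ι z) × A (ι z) w

  Prey₁₂ : C → C → Set
  Prey₁₂ u v = ∃ λ k → ι k ≢ u × ι k ≢ v × A u (ι k) × Path≤2 u v (ι k)

  Compete : C → C → Set
  Compete u v = Prey₁₂ u v ⊎ Prey₁₂ v u

  module Lift {N : ℕ} (label : Fin N → C) (vertex : K → Fin N)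
              (label-vertex : ∀ k → label (vertex k) ≡ ι k) where

    D : Digraph N
    D u v = A (label u) (label v)

    vertex-≢ : ∀ {k u} → ι k ≢ label u → vertex k ≢ u
    vertex-≢ {k} ne refl = ne (sym (label-vertex k))

    arc-lift : ∀ {u v a b} → label u ≡ a → label v ≡ b → A a b → D u v
    arc-lift refl refl uv = uv

    Prey₁₂-lift : ∀ {u v} → u ≢ v → Prey₁₂ (label u) (label v) →
                  ∃[ w ] (w ≢ u × w ≢ v × Dist≤1 D v u w × Dist≤2 D u v w)
    Prey₁₂-lift {u} {v} u≢v (k , k≢u , k≢v , u→k , v⇝k) =
      vertex k , w≢u , vertex-≢ k≢v , (u≢v , vertex-≢ k≢v , inj₂ (arc-lift refl (label-vertex k) u→k)) , lift v⇝k
      where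
      w≢u = vertex-≢ k≢u
      v≢u = λ e → u≢v (sym e)
      lift : Path≤2 (label u) (label v) (ι k) → Dist≤2 D u v (vertex k)
      lift (inj₁ v→k) = inj₁ (v≢u , w≢u , inj₂ (arc-lift refl (label-vertex k) v→k))
      lift (inj₂ (z , z≢u , v→z , z→k)) =
        inj₂ (v≢u , w≢u , vertex z , vertex-≢ z≢u , arc-lift refl (label-vertex z) v→z ,
              arc-lift (label-vertex z) (label-vertex k) z→k)

    C12-lift : ∀ {u v} → u ≢ v → Compete (label u) (label v) → C12 D u v
    C12-lift u≢v (inj₁ prey) with Prey₁₂-lift u≢v prey
    ... | w , w≢u , w≢v , d₁ , d₂ = u≢v , w , w≢u , w≢v , inj₁ (d₁ , d₂)
    C12-lift u≢v (inj₂ prey) with Prey₁₂-lift (λ e → u≢v (sym e)) prey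
    ... | w , w≢v , w≢u , d₁ , d₂ = u≢v , w , w≢u , w≢v , inj₂ (d₁ , d₂)

data Part : Set where
  X Y : Part

data Label : Set where
  core  : Part → Fin 6 → Label
  extra : Part → Label

part : Label → Part
part (core p _) = p
part (extra p)  = p

-- Row i lists, for j = 0 … 5, whether core X i → core Y j (otherwise core Y j → core X i).
tournament : Vec (Vec Bool 6) 6
tournament = (true  ∷ false ∷ false ∷ false ∷ true  ∷ true  ∷ [])
           ∷ (true  ∷ true  ∷ false ∷ true  ∷ false ∷ false ∷ [])
           ∷ (false ∷ false ∷ false ∷ true  ∷ true  ∷ true  ∷ [])
           ∷ (true  ∷ false ∷ true  ∷ true  ∷ false ∷ false ∷ [])
           ∷ (false ∷ true  ∷ true  ∷ false ∷ true  ∷ false ∷ [])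
           ∷ (false ∷ true  ∷ true  ∷ false ∷ false ∷ true  ∷ [])
           ∷ []

arc : Label → Label → Bool
arc (core X i) (core Y j) = lookup (lookup tournament i) j
arc (core Y j) (core X i) = not (lookup (lookup tournament i) j)
arc (extra X)  (core Y _) = true
arc (extra X)  (extra Y)  = true
arc (extra Y)  (core X _) = true
arc _          _          = false

Arc : Label → Label → Set
Arc c d = T (arc c d)

_≟ᴾ_ : DecidableEquality Part
X ≟ᴾ X = yes refl
X ≟ᴾ Y = no λ ()
Y ≟ᴾ X = no λ ()
Y ≟ᴾ Y = yes refl

_≟_ : DecidableEquality Label
core p i ≟ core q j = map′ (λ { (refl , refl) → refl }) (λ { refl → refl , refl }) ((p ≟ᴾ q) ×-dec (i F.≟ j))
core _ _ ≟ extra _  = no λ ()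
extra _  ≟ core _ _ = no λ ()
extra p  ≟ extra q  = map′ (cong extra) (λ { refl → refl }) (p ≟ᴾ q)

Core : Set
Core = Part × Fin 6

any-core? : {P : Core → Set} → Decidable P → Dec (∃ P)
any-core? P? =
  map′ (λ { (inj₁ (i , h)) → (X , i) , h ; (inj₂ (i , h)) → (Y , i) , h })
       (λ { ((X , i) , h) → inj₁ (i , h) ; ((Y , i) , h) → inj₂ (i , h) })
       (any? (P? ∘ (X ,_)) ⊎-dec any? (P? ∘ (Y ,_)))

all-labels? : {P : Label → Set} → Decidable P → Dec (∀ c → P c)
all-labels? P? =
  map′ (λ { (hX , hY , eX , eY) → λ { (core X i) → hX i ; (core Y i) → hY i ; (extra X) → eX ; (extra Y) → eY } })
       (λ h → h ∘ core X , h ∘ core Y , h (extra X) , h (extra Y))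
       (all? (P? ∘ core X) ×-dec all? (P? ∘ core Y) ×-dec P? (extra X) ×-dec P? (extra Y))

arc-between : ∀ c d → Arc c d → part c ≢ part d
arc-between = from-yes (all-labels? λ c → all-labels? λ d → T? (arc c d) →-dec ¬? (part c ≟ᴾ part d))

arc-total : ∀ c d → part c ≢ part d → Arc c d ⊎ Arc d c
arc-total = from-yes (all-labels? λ c → all-labels? λ d → ¬? (part c ≟ᴾ part d) →-dec (T? (arc c d) ⊎-dec T? (arc d c)))

arc-asym : ∀ c d → ¬ (Arc c d × Arc d c)
arc-asym = from-yes (all-labels? λ c → all-labels? λ d → ¬? (T? (arc c d) ×-dec T? (arc d c)))

open Competition Arc (Product.uncurry core)

-- Includes c ≡ d: distinct surplus vertices share a label.
compete : ∀ c d → Compete c d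
compete = from-yes (all-labels? λ c → all-labels? λ d → prey? c d ⊎-dec prey? d c)
  where
  path? : ∀ r v w → Dec (Path≤2 r v w)
  path? r v w = T? (arc v w) ⊎-dec any-core? λ (p , i) →
    ¬? (core p i ≟ r) ×-dec T? (arc v (core p i)) ×-dec T? (arc (core p i) w)
  prey? : ∀ u v → Dec (Prey₁₂ u v)
  prey? u v = any-core? λ (p , i) →
    ¬? (core p i ≟ u) ×-dec ¬? (core p i ≟ v) ×-dec T? (arc u (core p i)) ×-dec path? u v (core p i)

-- Vertices 0 … 5 of each part carry the core labels, the remaining ones the surplus label.
module Blowup (a b : ℕ) where

  m n : ℕ
  m = 6 + a
  n = 6 + b

  labelIn : ∀ {k} → Part → Fin (6 + k) → Label
  labelIn p j = [ core p , const (extra p) ]′ (splitAt 6 j)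

  label : Fin (m + n) → Label
  label v = [ labelIn X , labelIn Y ]′ (splitAt m v)

  vertex : Core → Fin (m + n)
  vertex (X , i) = (i ↑ˡ a) ↑ˡ n
  vertex (Y , i) = m ↑ʳ (i ↑ˡ b)

  label-vertex : ∀ k → label (vertex k) ≡ Product.uncurry core k
  label-vertex (X , i) rewrite splitAt-↑ˡ m (i ↑ˡ a) n | splitAt-↑ˡ 6 i a = refl
  label-vertex (Y , i) rewrite splitAt-↑ʳ m n (i ↑ˡ b) | splitAt-↑ˡ 6 i b = refl

  part-labelIn : ∀ {k} p (j : Fin (6 + k)) → part (labelIn p j) ≡ p
  part-labelIn p j with splitAt 6 j
  ... | inj₁ _ = refl
  ... | inj₂ _ = refl

  part-label : ∀ v → part (label v) ≡ [ const X , const Y ]′ (splitAt m v)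
  part-label v with splitAt m v
  ... | inj₁ j = part-labelIn X j
  ... | inj₂ j = part-labelIn Y j

  part-label-< : ∀ v → toℕ v < m → part (label v) ≡ X
  part-label-< v v<m = trans (part-label v) (cong [ const X , const Y ]′ (splitAt-< m v v<m))

  part-label-≥ : ∀ v → m ≤ toℕ v → part (label v) ≡ Y
  part-label-≥ v m≤v = trans (part-label v) (cong [ const X , const Y ]′ (splitAt-≥ m v m≤v))

  OppositeParts⇒part-≢ : ∀ u v → OppositeParts m n u v → part (label u) ≢ part (label v)
  OppositeParts⇒part-≢ u v (inj₁ (u<m , m≤v)) rewrite part-label-< u u<m | part-label-≥ v m≤v = λ ()
  OppositeParts⇒part-≢ u v (inj₂ (m≤u , v<m)) rewrite part-label-≥ u m≤u | part-label-< v v<m = λ ()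

  part-≢⇒OppositeParts : ∀ u v → part (label u) ≢ part (label v) → OppositeParts m n u v
  part-≢⇒OppositeParts u v ne with toℕ u <? m | toℕ v <? m
  ... | yes u<m | yes v<m = ⊥-elim (ne (trans (part-label-< u u<m) (sym (part-label-< v v<m))))
  ... | yes u<m | no  v≮m = inj₁ (u<m , ≮⇒≥ v≮m)
  ... | no  u≮m | yes v<m = inj₂ (≮⇒≥ u≮m , v<m)
  ... | no  u≮m | no  v≮m = ⊥-elim (ne (trans (part-label-≥ u (≮⇒≥ u≮m)) (sym (part-label-≥ v (≮⇒≥ v≮m)))))

  open Lift label vertex label-vertex public

  D-orientation : IsOrientationKmn m n D
  D-orientation =
    (λ u v u→v → part-≢⇒OppositeParts u v (arc-between (label u) (label v) u→v)) ,
    (λ u v opp → arc-total (label u) (label v) (OppositeParts⇒part-≢ u v opp)) ,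
    (λ u v → arc-asym (label u) (label v))

  C12-complete : ∀ {u v} → u ≢ v → C12 D u v
  C12-complete {u} {v} u≢v = C12-lift u≢v (compete (label u) (label v))

corollary4p1 : (m n : ℕ) → 6 ≤ n → n ≤ m →
    ∃[ D ] (IsOrientationKmn m n D × EdgeCount (C12 D) ((m + n) C 2))
corollary4p1 m n 6≤n n≤m
  with a , refl ← m≤n⇒∃[o]m+o≡n (≤-trans 6≤n n≤m)
     | b , refl ← m≤n⇒∃[o]m+o≡n 6≤n
  = let open Blowup a b in
    D , D-orientation , EdgeCount-complete (C12 D) C12-complete
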